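{- For all $n\ge 2$, the list $\mathcal{D}_n$ defined below satisfies $\mathcal{D}_n(1)=n\,1\,2\,3\cdots(n-1)$ and $\mathcal{D}_n(c_n)=1\,2\,3\cdots n$.
   Context: Let $c_n=\frac{1}{n+1}\binom{2n}{n}$ be the $n$-th Catalan number. Let $A(1)=0$ and $A(i)=c_0+c_1+\cdots+c_{i-2}$ for $i>1$. Lists of permutations are written as ordered sequences; the $j$-th entry of a list $\mathcal{D}_n$ is $\mathcal{D}_n(j)$. For a positive integer $i$, $\mathcal{D}_n^i$ denotes $\mathcal{D}_n$ if $i$ is odd and the reversal of $\mathcal{D}_n$ if $i$ is even, so $\mathcal{D}_n^i(j)=\mathcal{D}_n^{i+1}(c_n+1-j)$. For a permutation (word) $w$ and integer $l$, $w+l$ denotes $w$ with every entry increased by $l$. $[\alpha,n,\beta]$ denotes the word obtained by concatenating the word $\alpha$, the letter $n$, and the word $\beta$; concatenation with the empty permutation $\emptyset$ leaves a word unchanged. $\bigoplus$ denotes concatenation of lists in the order of the indices (outer index varying slowest). Define $\mathcal{D}_0=(\emptyset)$ and for $n\ge1$ $$\mathcal{D}_n=\bigoplus_{i=1}^{n}\bigoplus_{j=1}^{c_{i-1}}\bigoplus_{k=1}^{c_{n-i}}\left[\mathcal{D}_{i-1}^{\,n+i-1}(j),\ n,\ \mathcal{D}_{n-i}^{\,j+A(i)+1}(k)+(i-1)\right].$$ -}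

module Defs where

open import Data.Nat using (ℕ; zero; suc; _+_; _∸_; _/_)
open import Data.Nat.Combinatorics using (_C_)
open import Data.Bool using (if_then_else_)
open import Data.Nat using (_%_; _≡ᵇ_)
open import Data.List using (List; []; _∷_; _++_; map; upTo; reverse; concatMap)
open import Data.Nat.ListAction using (sum)

catalan : ℕ → ℕ
catalan n = ((2 * n) C n) / suc n
  where open import Data.Nat using (_*_)

A : ℕ → ℕ
A i = sum (map catalan (upTo (i ∸ 1)))

-- 1-based indexing: entry L j = L(j); out-of-range gives the empty word
entry : List (List ℕ) → ℕ → List ℕ
entry []       _             = []
entry (x ∷ _)  1             = x
entry (_ ∷ xs) (suc (suc j)) = entry xs (suc j)
entry (_ ∷ _)  zero          = []

oneTo : ℕ → List ℕ
oneTo m = map suc (upTo m)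

pow : List (List ℕ) → ℕ → List (List ℕ)
pow L i = if (i % 2) ≡ᵇ 1 then L else reverse L

shift : List ℕ → ℕ → List ℕ
shift w l = map (_+ l) w

get : List (List (List ℕ)) → ℕ → List (List ℕ)
get []       _       = []
get (x ∷ _)  zero    = x
get (_ ∷ xs) (suc k) = get xs k

-- one step of the recursion: build D_n from the table tbl = [D_0, ..., D_{n-1}]
step : ℕ → List (List (List ℕ)) → List (List ℕ)
step n tbl =
  concatMap (λ i →
    concatMap (λ j →
      map (λ k →
          entry (pow (get tbl (i ∸ 1)) (n + i ∸ 1)) j
            ++ (n ∷ shift (entry (pow (get tbl (n ∸ i)) (j + A i + 1)) k) (i ∸ 1)))
        (oneTo (catalan (n ∸ i))))
      (oneTo (catalan (i ∸ 1))))
    (oneTo n)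

table : ℕ → List (List (List ℕ))
table zero    = (([] ∷ [])) ∷ []
table (suc m) = table m ++ (step (suc m) (table m) ∷ [])

D : ℕ → List (List ℕ)
D n = get (table n) n

-- Unfolding the recursion once, the first word of D (n + 1) comes from the first block (i = 1, j = 1,
-- k = 1) and equals n + 1 followed by the first word of the reversed list D n, i.e. its last word; the
-- last word comes from the last block (i = n + 1, k = 1, j = c n) and equals the last word of D n
-- followed by n + 1.  By induction the last word of D n is 1 2 ⋯ n.  The only non-structural input is
-- that D n has exactly c n entries, which is the Catalan recurrence c (n + 1) = Σ c i · c (n − i) for
-- the binomial formula; it is obtained from ballot numbers, which satisfy both the reflection formula
-- and the first-return decomposition.
module Submission where

open import Defs
open import Data.Bool using (true; false)
open import Data.List
  using (List; []; _∷_; [_]; _++_; _∷ʳ_; map; upTo; applyUpTo; reverse; concatMap; length; _∷ʳ′_; initLast)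
open import Data.List.Properties
  using (length-++; length-map; length-upTo; map-++; map-cong; map-∘; map-id; map-upTo; upTo-∷ʳ;
         concatMap-++; concatMap-map; concatMap-pure; reverse-++; ++-assoc; ++-identityʳ)
open import Data.Nat using (ℕ; zero; suc; _+_; _*_; _∸_; _/_; _≤_; _<_; z≤n; s≤s; z<s; _%_; _≡ᵇ_)
open import Data.Nat.Properties
open import Data.Nat.Combinatorics using (_C_; nCk+nC[k+1]≡[n+1]C[k+1]; nCk≡nC[n∸k]; k>n⇒nCk≡0; nC1≡n)
open import Data.Nat.DivMod using (m*n/n≡m; [m+kn]%n≡m%n)
open import Data.Nat.ListAction using (sum)
open import Data.Product using (_×_; _,_)
open import Function using (_∘_)
open import Relation.Binary.PropositionalEquality using (_≡_; refl; sym; trans; cong; cong₂; subst; module ≡-Reasoning)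
open import Algebra.Properties.CommutativeSemigroup +-commutativeSemigroup using (interchange; xy∙z≈xz∙y)
open ≡-Reasoning

absorption : ∀ n k → suc k * (suc n C suc k) ≡ suc n * (n C k)
absorption zero    zero    = refl
absorption zero    (suc k) = begin
  suc (suc k) * (1 C suc (suc k)) ≡⟨ cong (suc (suc k) *_) (k>n⇒nCk≡0 {1} (s≤s (s≤s (z≤n {k})))) ⟩
  suc (suc k) * 0                 ≡⟨ *-zeroʳ (suc (suc k)) ⟩
  0                               ≡⟨ k>n⇒nCk≡0 {0} {suc k} z<s ⟨
  0 C suc k                       ≡⟨ +-identityʳ _ ⟨
  1 * (0 C suc k)                 ∎
absorption (suc n) zero    = begin
  1 * (suc (suc n) C 1) ≡⟨ *-identityˡ _ ⟩
  suc (suc n) C 1       ≡⟨ nC1≡n (suc (suc n)) ⟩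
  suc (suc n)           ≡⟨ *-identityʳ _ ⟨
  suc (suc n) * 1       ∎
absorption (suc n) (suc k) = begin
  k″ * (n″ C k″)                     ≡⟨ cong (k″ *_) (nCk+nC[k+1]≡[n+1]C[k+1] (suc n) (suc k)) ⟨
  k″ * (X + Y)                       ≡⟨ *-distribˡ-+ k″ X Y ⟩
  (X + suc k * X) + k″ * Y           ≡⟨ cong₂ (λ u v → (X + u) + v) (absorption n k) (absorption n (suc k)) ⟩
  (X + suc n * a) + suc n * b        ≡⟨ +-assoc X _ _ ⟩
  X + (suc n * a + suc n * b)        ≡⟨ cong (X +_) (*-distribˡ-+ (suc n) a b) ⟨
  X + suc n * (a + b)                ≡⟨ cong (λ z → X + suc n * z) (nCk+nC[k+1]≡[n+1]C[k+1] n k) ⟩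
  n″ * X                             ∎
  where
  k″ = suc (suc k)
  n″ = suc (suc n)
  X  = suc n C suc k
  Y  = suc n C k″
  a  = n C k
  b  = n C suc k

-- n C (k − 1), except that the junk value n C 0 at k = 0 is replaced by 0.
_C⁻_ : ℕ → ℕ → ℕ
n C⁻ zero  = 0
n C⁻ suc k = n C k

pascal : ∀ n k → suc n C k ≡ n C⁻ k + n C k
pascal n zero    = refl
pascal n (suc k) = sym (nCk+nC[k+1]≡[n+1]C[k+1] n k)

oddC-middle : ∀ t → suc (t + t) C suc t ≡ suc (t + t) C t
oddC-middle t = trans (nCk≡nC[n∸k] (s≤s (m≤m+n t t))) (cong (suc (t + t) C_) (m+n∸m≡n t t))

evenC-ratio : ∀ t → suc (suc t) * ((suc t + suc t) C t) ≡ suc t * ((suc t + suc t) C suc t)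
evenC-ratio t = begin
  suc (suc t) * (K C t)            ≡⟨ cong (suc (suc t) *_) K-sym ⟩
  suc (suc t) * (K C suc (suc t))  ≡⟨ absorption (t + suc t) (suc t) ⟩
  K * ((t + suc t) C suc t)        ≡⟨ cong (K *_) K-1-sym ⟩
  K * ((t + suc t) C t)            ≡⟨ absorption (t + suc t) t ⟨
  suc t * (K C suc t)              ∎
  where
  K = suc t + suc t
  K-sym : K C t ≡ K C suc (suc t)
  K-sym = begin
    K C t                     ≡⟨ nCk≡nC[n∸k] (≤-trans (m≤m+n t (suc t)) (n≤1+n _)) ⟩
    K C (K ∸ t)               ≡⟨ cong (λ x → K C (x ∸ t)) (+-suc t (suc t)) ⟨
    K C (t + suc (suc t) ∸ t) ≡⟨ cong (K C_) (m+n∸m≡n t (suc (suc t))) ⟩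
    K C suc (suc t)           ∎
  K-1-sym : (t + suc t) C suc t ≡ (t + suc t) C t
  K-1-sym = trans (nCk≡nC[n∸k] (m≤n+m (suc t) t)) (cong ((t + suc t) C_) (m+n∸n≡m t (suc t)))

-- ballot r s counts the ±1 paths from height r down to height 0 with s up-steps that never go below
-- height 0; the recursion splits on the first step.
ballot : ℕ → ℕ → ℕ
ballot r       zero    = 1
ballot zero    (suc s) = ballot 1 s
ballot (suc r) (suc s) = ballot r (suc s) + ballot (suc (suc r)) s

1≤ballot : ∀ r s → 1 ≤ ballot r s
1≤ballot r       zero    = ≤-refl
1≤ballot zero    (suc s) = 1≤ballot 1 s
1≤ballot (suc r) (suc s) = ≤-trans (1≤ballot r (suc s)) (m≤m+n _ _)

pathLength : ℕ → ℕ → ℕ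
pathLength r s = r + (s + s)

pathLength-suc : ∀ r s → pathLength r (suc s) ≡ pathLength (suc (suc r)) s
pathLength-suc r s = trans (cong (r +_) (cong suc (+-suc s s))) (trans (+-suc r _) (cong suc (+-suc r _)))

-- The reflection principle: ballot r s = C(r + 2s, s) − C(r + 2s, s − 1).
ballot+C⁻≡C : ∀ r s → ballot r s + pathLength r s C⁻ s ≡ pathLength r s C s
ballot+C⁻≡C r zero = refl
ballot+C⁻≡C zero (suc t) = subst (λ L → ballot 1 t + L C⁻ suc t ≡ L C suc t) (sym (pathLength-suc 0 t)) (begin
  ballot 1 t + suc N C t             ≡⟨ cong (ballot 1 t +_) (pascal N t) ⟩
  ballot 1 t + (N C⁻ t + N C t)      ≡⟨ +-assoc (ballot 1 t) _ _ ⟨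
  (ballot 1 t + N C⁻ t) + N C t      ≡⟨ cong (_+ N C t) (ballot+C⁻≡C 1 t) ⟩
  N C t + N C t                      ≡⟨ cong (N C t +_) (oddC-middle t) ⟨
  N C t + N C suc t                  ≡⟨ nCk+nC[k+1]≡[n+1]C[k+1] N t ⟩
  suc N C suc t                      ∎)
  where N = suc (t + t)
ballot+C⁻≡C (suc q) (suc t) = begin
  (a + b) + suc N C t              ≡⟨ cong (a + b +_) (pascal N t) ⟩
  (a + b) + (N C⁻ t + N C t)       ≡⟨ +-assoc (a + b) _ _ ⟨
  ((a + b) + N C⁻ t) + N C t       ≡⟨ cong (_+ N C t) (+-assoc a b _) ⟩
  (a + (b + N C⁻ t)) + N C t       ≡⟨ cong (λ z → (a + z) + N C t) shifted-ih ⟩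
  (a + N C t) + N C t              ≡⟨ cong (_+ N C t) (ballot+C⁻≡C q (suc t)) ⟩
  N C suc t + N C t                ≡⟨ +-comm (N C suc t) _ ⟩
  N C t + N C suc t                ≡⟨ nCk+nC[k+1]≡[n+1]C[k+1] N t ⟩
  suc N C suc t                    ∎
  where
  N = pathLength q (suc t)
  a = ballot q (suc t)
  b = ballot (suc (suc q)) t
  shifted-ih : b + N C⁻ t ≡ N C t
  shifted-ih = subst (λ L → b + L C⁻ t ≡ L C t) (sym (pathLength-suc q t)) (ballot+C⁻≡C (suc (suc q)) t)

catalan≡ballot : ∀ n → catalan n ≡ ballot 0 n
catalan≡ballot zero      = refl
catalan≡ballot n@(suc t) = begin
  ((2 * n) C n) / suc n   ≡⟨ cong (λ m → (m C n) / suc n) (cong (n +_) (+-identityʳ n)) ⟩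
  W / suc n               ≡⟨ cong (_/ suc n) W≡V*[n+1] ⟩
  (V * suc n) / suc n     ≡⟨ m*n/n≡m V (suc n) ⟩
  V                       ∎
  where
  V = ballot 0 n
  W = (n + n) C n
  Z = (n + n) C t
  W≡V*[n+1] : W ≡ V * suc n
  W≡V*[n+1] = +-cancelʳ-≡ (n * W) W (V * suc n) (begin
    suc n * W               ≡⟨ cong (suc n *_) (ballot+C⁻≡C 0 n) ⟨
    suc n * (V + Z)         ≡⟨ *-distribˡ-+ (suc n) V Z ⟩
    suc n * V + suc n * Z   ≡⟨ cong₂ _+_ (*-comm (suc n) V) (evenC-ratio t) ⟩
    V * suc n + n * W       ∎)

1≤catalan : ∀ n → 1 ≤ catalan n
1≤catalan n = subst (1 ≤_) (sym (catalan≡ballot n)) (1≤ballot 0 n)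

applyUpTo-cong : ∀ {f g : ℕ → ℕ} → (∀ k → f k ≡ g k) → ∀ n → applyUpTo f n ≡ applyUpTo g n
applyUpTo-cong {f} {g} f≗g n = trans (sym (map-upTo f n)) (trans (map-cong f≗g (upTo n)) (map-upTo g n))

sum-applyUpTo-+ : ∀ f g n → sum (applyUpTo (λ k → f k + g k) n) ≡ sum (applyUpTo f n) + sum (applyUpTo g n)
sum-applyUpTo-+ f g zero    = refl
sum-applyUpTo-+ f g (suc n) = trans (cong (f 0 + g 0 +_) (sum-applyUpTo-+ (f ∘ suc) (g ∘ suc) n))
                                    (interchange (f 0) (g 0) _ _)

convolution : (ℕ → ℕ) → (ℕ → ℕ) → ℕ → ℕ
convolution f g n = sum (applyUpTo (λ k → f k * g (n ∸ k)) (suc n))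

convolution-cong : ∀ {f f′ g g′ : ℕ → ℕ} → (∀ k → f k ≡ f′ k) → (∀ k → g k ≡ g′ k) →
                   ∀ n → convolution f g n ≡ convolution f′ g′ n
convolution-cong f≗f′ g≗g′ n = cong sum (applyUpTo-cong (λ k → cong₂ _*_ (f≗f′ k) (g≗g′ (n ∸ k))) (suc n))

convolution-+ʳ : ∀ f g h n → convolution f (λ k → g k + h k) n ≡ convolution f g n + convolution f h n
convolution-+ʳ f g h n =
  trans (cong sum (applyUpTo-cong (λ k → *-distribˡ-+ (f k) (g (n ∸ k)) (h (n ∸ k))) (suc n)))
        (sum-applyUpTo-+ (λ k → f k * g (n ∸ k)) (λ k → f k * h (n ∸ k)) (suc n))

convolution-last : ∀ f g n → convolution f g (suc n) ≡ convolution f (g ∘ suc) n + f (suc n) * g 0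
convolution-last f g zero    = trans (cong (f 0 * g 1 +_) (+-identityʳ _))
                                     (cong (_+ f 1 * g 0) (sym (+-identityʳ _)))
convolution-last f g (suc n) = trans (cong (f 0 * g (suc (suc n)) +_) (convolution-last (f ∘ suc) g n))
                                     (sym (+-assoc (f 0 * g (suc (suc n))) _ _))

-- The first-return decomposition of a path from height r + 1: a Dyck path of some length k at height
-- r + 1, a down-step, then a path from height r.
ballot-convolution : ∀ n r → ballot (suc r) n ≡ convolution (ballot 0) (ballot r) n
ballot-convolution zero    r       = refl
ballot-convolution (suc n) zero    = begin
  c₀ (suc n) + ballot 2 n                 ≡⟨ cong (c₀ (suc n) +_) (ballot-convolution n 1) ⟩
  c₀ (suc n) + convolution c₀ (ballot 1) n ≡⟨ +-comm (c₀ (suc n)) _ ⟩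
  convolution c₀ (ballot 1) n + c₀ (suc n) ≡⟨ cong (convolution c₀ (ballot 1) n +_) (*-identityʳ _) ⟨
  convolution c₀ (ballot 1) n + c₀ (suc n) * 1 ≡⟨ convolution-last c₀ c₀ n ⟨
  convolution c₀ c₀ (suc n)                ∎
  where c₀ = ballot 0
ballot-convolution (suc n) (suc r) = begin
  ballot (suc r) (suc n) + ballot (3 + r) n
    ≡⟨ cong₂ _+_ (ballot-convolution (suc n) r) (ballot-convolution n (2 + r)) ⟩
  convolution c₀ (ballot r) (suc n) + S       ≡⟨ cong (_+ S) (convolution-last c₀ (ballot r) n) ⟩
  (F + E) + S                                 ≡⟨ xy∙z≈xz∙y F E S ⟩
  (F + S) + E                                 ≡⟨ cong (_+ E) (convolution-+ʳ c₀ (ballot r ∘ suc) (ballot (2 + r)) n) ⟨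
  convolution c₀ (ballot (suc r) ∘ suc) n + E ≡⟨ convolution-last c₀ (ballot (suc r)) n ⟨
  convolution c₀ (ballot (suc r)) (suc n)     ∎
  where
  c₀ = ballot 0
  F  = convolution c₀ (ballot r ∘ suc) n
  E  = c₀ (suc n) * ballot r 0
  S  = convolution c₀ (ballot (2 + r)) n

catalan-recurrence : ∀ n → catalan (suc n) ≡ convolution catalan catalan n
catalan-recurrence n = begin
  catalan (suc n)                          ≡⟨ catalan≡ballot (suc n) ⟩
  ballot 1 n                               ≡⟨ ballot-convolution n 0 ⟩
  convolution (ballot 0) (ballot 0) n      ≡⟨ convolution-cong catalan≡ballot catalan≡ballot n ⟨
  convolution catalan catalan n            ∎

oneTo-suc : ∀ n → oneTo (suc n) ≡ oneTo n ∷ʳ suc n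
oneTo-suc n = trans (cong (map suc) (sym (upTo-∷ʳ n))) (map-++ suc (upTo n) (n ∷ []))

length-oneTo : ∀ n → length (oneTo n) ≡ n
length-oneTo n = trans (length-map suc (upTo n)) (length-upTo n)

length-concatMap : ∀ {A B : Set} (f : A → List B) xs → length (concatMap f xs) ≡ sum (map (length ∘ f) xs)
length-concatMap f []       = refl
length-concatMap f (x ∷ xs) = trans (length-++ (f x)) (cong (length (f x) +_) (length-concatMap f xs))

length-concatMap-const : ∀ {A B : Set} (f : A → List B) {c} → (∀ x → length (f x) ≡ c) →
                         ∀ xs → length (concatMap f xs) ≡ length xs * c
length-concatMap-const f ∣f∣≡c []       = refl
length-concatMap-const f ∣f∣≡c (x ∷ xs) =
  trans (length-++ (f x)) (cong₂ _+_ (∣f∣≡c x) (length-concatMap-const f ∣f∣≡c xs))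

lastEntry : List (List ℕ) → List ℕ
lastEntry L = entry L (length L)

entry-∷ʳ : ∀ xs y → entry (xs ∷ʳ y) (suc (length xs)) ≡ y
entry-∷ʳ []       y = refl
entry-∷ʳ (x ∷ xs) y = entry-∷ʳ xs y

lastEntry-∷ʳ : ∀ xs y → lastEntry (xs ∷ʳ y) ≡ y
lastEntry-∷ʳ xs y = trans (cong (entry (xs ∷ʳ y)) (trans (length-++ xs) (+-comm (length xs) 1))) (entry-∷ʳ xs y)

entry-reverse : ∀ L → entry (reverse L) 1 ≡ lastEntry L
entry-reverse L with initLast L
... | []      = refl
... | xs ∷ʳ′ x = trans (cong (λ R → entry R 1) (reverse-++ xs (x ∷ []))) (sym (lastEntry-∷ʳ xs x))

lastEntry-++-map-oneTo : ∀ xs (g : ℕ → List ℕ) {k} → 1 ≤ k → lastEntry (xs ++ map g (oneTo k)) ≡ g k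
lastEntry-++-map-oneTo xs g {suc n} _ = begin
  lastEntry (xs ++ map g (oneTo (suc n)))          ≡⟨ cong (λ l → lastEntry (xs ++ map g l)) (oneTo-suc n) ⟩
  lastEntry (xs ++ map g (oneTo n ∷ʳ suc n))       ≡⟨ cong (λ l → lastEntry (xs ++ l)) (map-++ g (oneTo n) _) ⟩
  lastEntry (xs ++ map g (oneTo n) ∷ʳ g (suc n))   ≡⟨ cong lastEntry (++-assoc xs (map g (oneTo n)) _) ⟨
  lastEntry ((xs ++ map g (oneTo n)) ∷ʳ g (suc n)) ≡⟨ lastEntry-∷ʳ (xs ++ map g (oneTo n)) _ ⟩
  g (suc n)                                        ∎

get-++ˡ : ∀ xs ys {k} → k < length xs → get (xs ++ ys) k ≡ get xs k
get-++ˡ (x ∷ xs) ys {zero}  _         = refl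
get-++ˡ (x ∷ xs) ys {suc k} (s≤s k<n) = get-++ˡ xs ys k<n

get-∷ʳ : ∀ xs x → get (xs ∷ʳ x) (length xs) ≡ x
get-∷ʳ []       x = refl
get-∷ʳ (y ∷ xs) x = get-∷ʳ xs x

length-table : ∀ m → length (table m) ≡ suc m
length-table zero    = refl
length-table (suc m) = trans (length-++ (table m)) (trans (cong (_+ 1) (length-table m)) (+-comm (suc m) 1))

get-table-0 : ∀ m → get (table m) 0 ≡ D 0
get-table-0 zero    = refl
get-table-0 (suc m) = trans (get-++ˡ (table m) _ (subst (0 <_) (sym (length-table m)) z<s)) (get-table-0 m)

D-suc : ∀ m → D (suc m) ≡ step (suc m) (table m)
D-suc m = subst (λ k → get (table m ∷ʳ step (suc m) (table m)) k ≡ step (suc m) (table m))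
                (length-table m) (get-∷ʳ (table m) (step (suc m) (table m)))

pow-singleton : ∀ w i → pow (w ∷ []) i ≡ w ∷ []
pow-singleton w i with (i % 2) ≡ᵇ 1
... | true  = refl
... | false = refl

[m+suc-m]%2≡1 : ∀ m → (m + suc m) % 2 ≡ 1
[m+suc-m]%2≡1 m = begin
  (m + suc m) % 2   ≡⟨ cong (_% 2) (+-suc m m) ⟩
  (1 + (m + m)) % 2 ≡⟨ cong (λ z → (1 + (m + z)) % 2) (+-identityʳ m) ⟨
  (1 + 2 * m) % 2   ≡⟨ cong (λ z → (1 + z) % 2) (*-comm 2 m) ⟩
  (1 + m * 2) % 2   ≡⟨ [m+kn]%n≡m%n 1 m 2 ⟩
  1                 ∎

pow-odd : ∀ L m → pow L (m + suc m) ≡ L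
pow-odd L m rewrite [m+suc-m]%2≡1 m = refl

shift-0 : ∀ w → shift w 0 ≡ w
shift-0 w = trans (map-cong +-identityʳ w) (map-id w)

word : ℕ → List (List (List ℕ)) → ℕ → ℕ → ℕ → List ℕ
word n tbl i j k = entry (pow (get tbl (i ∸ 1)) (n + i ∸ 1)) j
                   ++ (n ∷ shift (entry (pow (get tbl (n ∸ i)) (j + A i + 1)) k) (i ∸ 1))

block : ℕ → List (List (List ℕ)) → ℕ → List (List ℕ)
block n tbl i = concatMap (λ j → map (word n tbl i j) (oneTo (catalan (n ∸ i)))) (oneTo (catalan (i ∸ 1)))

length-block : ∀ n tbl i → length (block n tbl i) ≡ catalan (i ∸ 1) * catalan (n ∸ i)
length-block n tbl i =
  trans (length-concatMap-const row length-row (oneTo (catalan (i ∸ 1))))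
        (cong (_* catalan (n ∸ i)) (length-oneTo (catalan (i ∸ 1))))
  where
  row : ℕ → List (List ℕ)
  row j = map (word n tbl i j) (oneTo (catalan (n ∸ i)))
  length-row : ∀ j → length (row j) ≡ catalan (n ∸ i)
  length-row j = trans (length-map (word n tbl i j) (oneTo (catalan (n ∸ i)))) (length-oneTo (catalan (n ∸ i)))

length-step : ∀ m tbl → length (step (suc m) tbl) ≡ catalan (suc m)
length-step m tbl = begin
  length (concatMap (block n tbl) (oneTo n))         ≡⟨ length-concatMap (block n tbl) (oneTo n) ⟩
  sum (map (length ∘ block n tbl) (oneTo n))        ≡⟨ cong sum (map-cong (length-block n tbl) (oneTo n)) ⟩
  sum (map blockSize (map suc (upTo n)))            ≡⟨ cong sum (map-∘ (upTo n)) ⟨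
  sum (map (blockSize ∘ suc) (upTo n))              ≡⟨ cong sum (map-upTo (blockSize ∘ suc) n) ⟩
  convolution catalan catalan m                     ≡⟨ catalan-recurrence m ⟨
  catalan n                                         ∎
  where
  n = suc m
  blockSize : ℕ → ℕ
  blockSize i = catalan (i ∸ 1) * catalan (n ∸ i)

length-D : ∀ n → length (D n) ≡ catalan n
length-D zero    = refl
length-D (suc m) = trans (cong length (D-suc m)) (length-step m (table m))

entry-1-block : ∀ (g : ℕ → ℕ → List ℕ) {c} → 1 ≤ c → ∀ ys →
                entry (concatMap (λ j → map (g j) (oneTo c)) (oneTo 1) ++ ys) 1 ≡ g 1 1
entry-1-block g (s≤s z≤n) ys = refl

entry-pow-D₀ : ∀ m i → entry (pow (get (table m) 0) i) 1 ≡ []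
entry-pow-D₀ m i rewrite get-table-0 m | pow-singleton [] i = refl

D-first : ∀ m → entry (D (suc m)) 1 ≡ suc m ∷ lastEntry (D m)
D-first m = begin
  entry (D n) 1                 ≡⟨ cong (λ L → entry L 1) (D-suc m) ⟩
  -- step n T unfolds definitionally to block n T 1 ++ ⋯ with block n T 1 of the shape in entry-1-block.
  entry (step n T) 1            ≡⟨ entry-1-block (word n T 1) (1≤catalan m) _ ⟩
  word n T 1 1 1                ≡⟨ cong₂ (λ u v → u ++ n ∷ v) (entry-pow-D₀ m (n + 1 ∸ 1)) (shift-0 _) ⟩
  n ∷ entry (reverse (D m)) 1   ≡⟨ cong (n ∷_) (entry-reverse (D m)) ⟩
  n ∷ lastEntry (D m)           ∎
  where
  n = suc m
  T = table m

last-block : ∀ m tbl → block (suc m) tbl (suc m) ≡ map (λ j → word (suc m) tbl (suc m) j 1) (oneTo (catalan m))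
last-block m tbl = begin
  concatMap (λ j → map (w j) (oneTo (catalan (m ∸ m)))) (oneTo (catalan m))
    ≡⟨ cong (λ c → concatMap (λ j → map (w j) (oneTo (catalan c))) (oneTo (catalan m))) (n∸n≡0 m) ⟩
  concatMap ([_] ∘ (λ j → w j 1)) (oneTo (catalan m))
    ≡⟨ concatMap-map [_] (λ j → w j 1) (oneTo (catalan m)) ⟨
  concatMap [_] (map (λ j → w j 1) (oneTo (catalan m)))
    ≡⟨ concatMap-pure _ ⟩
  map (λ j → w j 1) (oneTo (catalan m)) ∎
  where w = word (suc m) tbl (suc m)

step-last-block : ∀ m tbl → step (suc m) tbl ≡
  concatMap (block (suc m) tbl) (oneTo m) ++ map (λ j → word (suc m) tbl (suc m) j 1) (oneTo (catalan m))
step-last-block m tbl = begin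
  concatMap (block n tbl) (oneTo n)                     ≡⟨ cong (concatMap (block n tbl)) (oneTo-suc m) ⟩
  concatMap (block n tbl) (oneTo m ∷ʳ n)                ≡⟨ concatMap-++ (block n tbl) (oneTo m) (n ∷ []) ⟩
  concatMap (block n tbl) (oneTo m) ++ (block n tbl n ++ [])
    ≡⟨ cong (concatMap (block n tbl) (oneTo m) ++_) (trans (++-identityʳ _) (last-block m tbl)) ⟩
  concatMap (block n tbl) (oneTo m) ++ map (λ j → word n tbl n j 1) (oneTo (catalan m)) ∎
  where n = suc m

word-last : ∀ m j → word (suc m) (table m) (suc m) j 1 ≡ entry (D m) j ∷ʳ suc m
word-last m j = cong₂ (λ u v → entry u j ++ suc m ∷ v) (pow-odd (D m) m) (cong (λ w → shift w m) corner)
  where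
  corner : entry (pow (get (table m) (m ∸ m)) (j + A (suc m) + 1)) 1 ≡ []
  corner = trans (cong (λ k → entry (pow (get (table m) k) (j + A (suc m) + 1)) 1) (n∸n≡0 m))
                 (entry-pow-D₀ m (j + A (suc m) + 1))

D-last : ∀ m → lastEntry (D (suc m)) ≡ lastEntry (D m) ∷ʳ suc m
D-last m = begin
  lastEntry (D n)                                       ≡⟨ cong lastEntry (D-suc m) ⟩
  lastEntry (step n T)                                  ≡⟨ cong lastEntry (step-last-block m T) ⟩
  lastEntry (concatMap (block n T) (oneTo m) ++ map (λ j → word n T n j 1) (oneTo (catalan m)))
    ≡⟨ lastEntry-++-map-oneTo (concatMap (block n T) (oneTo m)) (λ j → word n T n j 1) (1≤catalan m) ⟩
  word n T n (catalan m) 1                              ≡⟨ word-last m (catalan m) ⟩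
  entry (D m) (catalan m) ∷ʳ n                          ≡⟨ cong (λ k → entry (D m) k ∷ʳ n) (length-D m) ⟨
  lastEntry (D m) ∷ʳ n                                  ∎
  where
  n = suc m
  T = table m

lastEntry-D : ∀ n → lastEntry (D n) ≡ oneTo n
lastEntry-D zero    = refl
lastEntry-D (suc m) = trans (D-last m) (trans (cong (_∷ʳ suc m) (lastEntry-D m)) (sym (oneTo-suc m)))

-- The hypothesis 2 ≤ n only excludes n = 0; the statement holds for n = 1 as well.
lemma2p2 : (n : ℕ) → 2 ≤ n →
    (entry (D n) 1 ≡ n ∷ oneTo (n ∸ 1)) × (entry (D n) (catalan n) ≡ oneTo n)
lemma2p2 n@(suc m) _ =
  trans (D-first m) (cong (n ∷_) (lastEntry-D m)) ,
  trans (cong (entry (D n)) (sym (length-D n))) (lastEntry-D n)
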